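{- Let $\Gamma$ be an inner ultrahomogeneous group. Then the commutator subgroup $[\Gamma,\Gamma]$ equals the subgroup generated by the set of squares $\{g^2: g\in\Gamma\}$. In particular, if $\Gamma$ is $2$-divisible then $[\Gamma,\Gamma]=\Gamma$. In any case, $[\Gamma:[\Gamma,\Gamma]]\leq 2$.
   Context: Conjugation is written $g^h=h^{ -1}gh$. A finite partial automorphism of a group $G$ is an isomorphism between two finitely generated subgroups of $G$. A group $\Gamma$ is inner ultrahomogeneous if for every finite partial automorphism $p$ of $\Gamma$ there is some $g\in\Gamma$ such that $a^g=p(a)$ for all $a\in\operatorname{dom}p$. -}

module Defs where

open import Level using (Level; _⊔_)
open import Algebra.Bundles using (Group)
open import Data.List using (List)
open import Data.List.Relation.Unary.Any using (Any)
open import Data.Product using (Σ; ∃; _×_)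
open import Relation.Nullary using (¬_)

module _ {c ℓ : Level} (G : Group c ℓ) where
  open Group G

  conj : Carrier → Carrier → Carrier
  conj g h = (h ⁻¹ ∙ g) ∙ h

  commutator : Carrier → Carrier → Carrier
  commutator a b = ((a ⁻¹ ∙ b ⁻¹) ∙ a) ∙ b

  data Gen {p : Level} (S : Carrier → Set p) : Carrier → Set (c ⊔ ℓ ⊔ p) where
    gen  : ∀ {x} → S x → Gen S x
    one  : Gen S ε
    mul  : ∀ {x y} → Gen S x → Gen S y → Gen S (x ∙ y)
    inv  : ∀ {x} → Gen S x → Gen S (x ⁻¹)
    resp : ∀ {x y} → x ≈ y → Gen S x → Gen S y

  FinGen : List Carrier → Carrier → Set (c ⊔ ℓ)
  FinGen as = Gen (λ x → Any (x ≈_) as)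

  record FinPartialAut : Set (c ⊔ ℓ) where
    field
      dom-gens : List Carrier
      cod-gens : List Carrier
      fun      : (x : Carrier) → FinGen dom-gens x → Carrier
      fun-cong : ∀ {x y} (p : FinGen dom-gens x) (q : FinGen dom-gens y) →
                 x ≈ y → fun x p ≈ fun y q
      fun-hom  : ∀ {x y} (p : FinGen dom-gens x) (q : FinGen dom-gens y)
                 (r : FinGen dom-gens (x ∙ y)) →
                 fun (x ∙ y) r ≈ fun x p ∙ fun y q
      fun-inj  : ∀ {x y} (p : FinGen dom-gens x) (q : FinGen dom-gens y) →
                 fun x p ≈ fun y q → x ≈ y
      fun-into : ∀ {x} (p : FinGen dom-gens x) → FinGen cod-gens (fun x p)
      fun-onto : ∀ {y} → FinGen cod-gens y →
                 Σ Carrier λ x → Σ (FinGen dom-gens x) λ p → fun x p ≈ y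

  InnerUltrahomogeneous : Set (c ⊔ ℓ)
  InnerUltrahomogeneous =
    (φ : FinPartialAut) → Σ Carrier λ g →
      ∀ x (p : FinGen (FinPartialAut.dom-gens φ) x) →
        conj x g ≈ FinPartialAut.fun φ x p

  IsCommutator : Carrier → Set (c ⊔ ℓ)
  IsCommutator x = Σ Carrier λ a → Σ Carrier λ b → x ≈ commutator a b

  IsSquare : Carrier → Set (c ⊔ ℓ)
  IsSquare x = Σ Carrier λ g → x ≈ g ∙ g

  CommutatorSubgroup : Carrier → Set (c ⊔ ℓ)
  CommutatorSubgroup = Gen IsCommutator

  SquareSubgroup : Carrier → Set (c ⊔ ℓ)
  SquareSubgroup = Gen IsSquare

  TwoDivisible : Set (c ⊔ ℓ)
  TwoDivisible = ∀ x → Σ Carrier λ g → g ∙ g ≈ x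

  -- index of a subgroup N is at most 2: there are no three elements lying
  -- in pairwise distinct (left) cosets of N
  IndexAtMostTwo : {p : Level} → (Carrier → Set p) → Set (c ⊔ p)
  IndexAtMostTwo N = ∀ x y z →
    ¬ (¬ N (x ⁻¹ ∙ y) × ¬ N (x ⁻¹ ∙ z) × ¬ N (y ⁻¹ ∙ z))

-- In an inner ultrahomogeneous group, two elements a and b of the same order are
-- conjugate: a ↦ b extends to an isomorphism ⟨a⟩ → ⟨b⟩, which is realised by some
-- g, and then a⁻¹b = [a, g] is a commutator.  Applied to g⁻¹ and g this puts every
-- square into [Γ,Γ]; conversely [a,b] = a⁻²(ab⁻¹)²b² is a product of squares.
-- Hence two elements of infinite order are congruent modulo [Γ,Γ], and so are two
-- elements of finite order outside [Γ,Γ]: writing the order as 2ⁱ times an odd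
-- number, an element is congruent to an odd power of itself of order 2ⁱ, and if
-- two elements have orders 2ⁱ and 2ʲ with i < j, the first is conjugate to the
-- square y^(2^(j-i)) of the second.  Among u, v and uv two orders are of the same
-- kind, so u, v ∉ [Γ,Γ] forces uv ∈ [Γ,Γ], i.e. the index is at most 2.  Orders
-- exist only classically, which suffices because that last statement is a negation.
module Submission where

open import Defs
open import Level using (Level; _⊔_)
open import Algebra.Bundles using (Group)
open import Data.Empty using (⊥)
open import Data.List using ([]; _∷_)
open import Data.List.Relation.Unary.Any using (here)
import Data.Nat as ℕ
open ℕ using (ℕ; zero; suc; _+_; _*_; _<_; s≤s; NonZero)
open import Data.Nat.Properties
  using (+-comm; +-identityʳ; +-suc; *-assoc; m≤m+n; ≤-total; m≤n⇒∃[o]m+o≡n; <-cmp;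
         ^-distribˡ-+-*; m^n≢0)
open import Data.Nat.Divisibility
  using (_∣_; divides; _∣0; 0∣⇒≡0; n∣m*n; *-monoˡ-∣; *-cancelʳ-∣; m%n≡0⇒n∣m)
open import Data.Nat.DivMod using (_%_; _/_; m≡m%n+[m/n]*n; m%n<n)
open import Data.Nat.Induction using (<-rec)
open import Data.Product using (_×_; ∃; ∃₂; _,_; swap)
open import Data.Sum using (_⊎_; inj₁; inj₂)
open import Function using (_∘_)
open import Function.Bundles using (_⇔_; mk⇔; Equivalence)
open import Function.Construct.Composition using (_⇔-∘_)
open import Function.Construct.Symmetry using (⇔-sym)
open import Relation.Binary.Core using (Rel)
open import Relation.Binary.Definitions using (tri<; tri≈; tri>)
import Relation.Binary.PropositionalEquality as ≡
open ≡ using (_≡_)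
open import Relation.Nullary using (¬_; yes; no; contradiction)
open import Relation.Nullary.Decidable using (¬¬-excluded-middle)
open import Relation.Unary using (Pred; _⊆_)

open Equivalence using (to; from)

IsLeast : ∀ {p} → Pred ℕ p → Pred ℕ p
IsLeast P m = P m × (∀ {k} → k < m → ¬ P k)

¬¬-least : ∀ {p} (P : Pred ℕ p) {n} → P n → ¬ ¬ ∃ (IsLeast P)
¬¬-least P {n} = <-rec (λ n → P n → ¬ ¬ ∃ (IsLeast P)) step n
  where
  step : ∀ n → (∀ {m} → m < n → P m → ¬ ¬ ∃ (IsLeast P)) → P n → ¬ ¬ ∃ (IsLeast P)
  step n below Pn noLeast = ¬¬-excluded-middle {A = ∃ λ k → k < n × P k} λ where
    (yes (k , k<n , Pk)) → below k<n Pk noLeast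
    (no noneBelow)       → noLeast (n , Pn , λ k<n Pk → noneBelow (_ , k<n , Pk))

even⊎odd : ∀ n → ∃ λ q → n ≡ 2 * q ⊎ n ≡ suc (2 * q)
even⊎odd zero = 0 , inj₁ ≡.refl
even⊎odd (suc n) with even⊎odd n
... | q , inj₁ ≡.refl = q , inj₂ ≡.refl
... | q , inj₂ ≡.refl = suc q , inj₁ (≡.cong suc (≡.sym (+-suc q (q + 0))))

1+n≡2^i*[1+2s] : ∀ n → ∃₂ λ i s → suc n ≡ 2 ℕ.^ i * suc (2 * s)
1+n≡2^i*[1+2s] = <-rec _ step
  where
  step : ∀ n → (∀ {m} → m < n → ∃₂ λ i s → suc m ≡ 2 ℕ.^ i * suc (2 * s)) →
         ∃₂ λ i s → suc n ≡ 2 ℕ.^ i * suc (2 * s)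
  step n below with even⊎odd n
  ... | q , inj₁ ≡.refl = 0 , q , ≡.sym (+-identityʳ _)
  ... | q , inj₂ ≡.refl with below (s≤s (m≤m+n q (q + 0)))
  ...   | i , s , eq = suc i , s , (begin
    suc (suc (2 * q))           ≡⟨ ≡.cong suc (+-suc q (q + 0)) ⟨
    2 * suc q                   ≡⟨ ≡.cong (2 *_) eq ⟩
    2 * (2 ℕ.^ i * suc (2 * s)) ≡⟨ *-assoc 2 (2 ℕ.^ i) _ ⟨
    2 ℕ.^ suc i * suc (2 * s)   ∎)
    where open ≡.≡-Reasoning

_+±_ : ℕ × ℕ → ℕ × ℕ → ℕ × ℕ
(m₁ , n₁) +± (m₂ , n₂) = m₁ + m₂ , n₂ + n₁

module _ {c ℓ : Level} (G : Group c ℓ) where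
  open Group G
  open import Algebra.Properties.Group G
  import Algebra.Properties.Monoid.Mult monoid as Mult
  open import Relation.Binary.Reasoning.Setoid setoid

  private
    C : Pred Carrier (c ⊔ ℓ)
    C = CommutatorSubgroup G

  \\-∙-\\ : ∀ x y z → (x \\ y) ∙ (y \\ z) ≈ x \\ z
  \\-∙-\\ x y z = trans (assoc _ _ _) (∙-congˡ (\\-leftDividesˡ y z))

  //-∙-cancel : ∀ x y z → (x // y) ∙ (y ∙ z) ≈ x ∙ z
  //-∙-cancel x y z = trans (assoc _ _ _) (∙-congˡ (\\-leftDividesʳ y z))

  comm⇒⁻¹-comm : ∀ {x y} → y ∙ x ≈ x ∙ y → y ⁻¹ ∙ x ≈ x ∙ y ⁻¹
  comm⇒⁻¹-comm {x} {y} yx≈xy = begin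
    y ⁻¹ ∙ x              ≈⟨ //-rightDividesʳ y (y ⁻¹ ∙ x) ⟨
    (y ⁻¹ ∙ x ∙ y) // y   ≈⟨ ∙-congʳ (assoc _ _ _) ⟩
    (y ⁻¹ ∙ (x ∙ y)) // y ≈⟨ ∙-congʳ (∙-congˡ yx≈xy) ⟨
    (y \\ (y ∙ x)) // y   ≈⟨ ∙-congʳ (\\-leftDividesʳ y x) ⟩
    x // y                ∎

  //-∙-// : ∀ {x₁ y₁ x₂ y₂} → y₁ ∙ x₂ ≈ x₂ ∙ y₁ →
           (x₁ // y₁) ∙ (x₂ // y₂) ≈ (x₁ ∙ x₂) // (y₂ ∙ y₁)
  //-∙-// {x₁} {y₁} {x₂} {y₂} y₁x₂≈x₂y₁ = begin
    x₁ ∙ y₁ ⁻¹ ∙ (x₂ ∙ y₂ ⁻¹)     ≈⟨ assoc _ _ _ ⟩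
    x₁ ∙ (y₁ ⁻¹ ∙ (x₂ ∙ y₂ ⁻¹))   ≈⟨ ∙-congˡ (assoc _ _ _) ⟨
    x₁ ∙ (y₁ ⁻¹ ∙ x₂ ∙ y₂ ⁻¹)     ≈⟨ ∙-congˡ (∙-congʳ (comm⇒⁻¹-comm y₁x₂≈x₂y₁)) ⟩
    x₁ ∙ (x₂ ∙ y₁ ⁻¹ ∙ y₂ ⁻¹)     ≈⟨ ∙-congˡ (assoc _ _ _) ⟩
    x₁ ∙ (x₂ ∙ (y₁ ⁻¹ ∙ y₂ ⁻¹))   ≈⟨ assoc _ _ _ ⟨
    x₁ ∙ x₂ ∙ (y₁ ⁻¹ ∙ y₂ ⁻¹)     ≈⟨ ∙-congˡ (⁻¹-anti-homo-∙ y₂ y₁) ⟨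
    (x₁ ∙ x₂) // (y₂ ∙ y₁)        ∎

  Gen-⊆ : ∀ {p q} {S : Pred Carrier p} {T : Pred Carrier q} →
          S ⊆ Gen G T → Gen G S ⊆ Gen G T
  Gen-⊆ S⊆T (gen s)    = S⊆T s
  Gen-⊆ S⊆T one        = one
  Gen-⊆ S⊆T (mul x y)  = mul (Gen-⊆ S⊆T x) (Gen-⊆ S⊆T y)
  Gen-⊆ S⊆T (inv x)    = inv (Gen-⊆ S⊆T x)
  Gen-⊆ S⊆T (resp e x) = resp e (Gen-⊆ S⊆T x)

  module Cosets {p} (S : Pred Carrier p) where
    infix 4 _∼_
    _∼_ : Rel Carrier (c ⊔ ℓ ⊔ p)
    x ∼ y = Gen G S (x \\ y)

    ∼-sym : ∀ {x y} → x ∼ y → y ∼ x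
    ∼-sym {x} {y} x∼y = resp (⁻¹-anti-homo-\\ x y) (inv x∼y)

    ∼-trans : ∀ {x y z} → x ∼ y → y ∼ z → x ∼ z
    ∼-trans {x} {y} {z} x∼y y∼z = resp (\\-∙-\\ x y z) (mul x∼y y∼z)

    ∈-resp-∼ : ∀ {x y} → x ∼ y → Gen G S x → Gen G S y
    ∈-resp-∼ {x} {y} x∼y x∈ = resp (\\-leftDividesˡ x y) (mul x∈ x∼y)

  open Cosets (IsCommutator G)

  ∼-conj : ∀ x g → x ∼ conj G x g
  ∼-conj x g = gen (x , g , sym (trans (∙-congʳ (assoc _ _ _)) (assoc _ _ _)))

  squares≈commutator : ∀ a b →
    a ⁻¹ ∙ a ⁻¹ ∙ (a ∙ b ⁻¹ ∙ (a ∙ b ⁻¹)) ∙ (b ∙ b) ≈ commutator G a b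
  squares≈commutator a b = begin
    a ⁻¹ ∙ a ⁻¹ ∙ (a ∙ b ⁻¹ ∙ (a ∙ b ⁻¹)) ∙ (b ∙ b)
      ≈⟨ ∙-congʳ (assoc _ _ _) ⟩
    a ⁻¹ ∙ (a ⁻¹ ∙ (a ∙ b ⁻¹ ∙ (a ∙ b ⁻¹))) ∙ (b ∙ b)
      ≈⟨ ∙-congʳ (∙-congˡ (assoc _ _ _)) ⟨
    a ⁻¹ ∙ ((a \\ (a ∙ b ⁻¹)) ∙ (a ∙ b ⁻¹)) ∙ (b ∙ b)
      ≈⟨ ∙-congʳ (∙-congˡ (∙-congʳ (\\-leftDividesʳ a (b ⁻¹)))) ⟩
    a ⁻¹ ∙ (b ⁻¹ ∙ (a ∙ b ⁻¹)) ∙ (b ∙ b)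
      ≈⟨ ∙-congʳ (assoc _ _ _) ⟨
    a ⁻¹ ∙ b ⁻¹ ∙ (a ∙ b ⁻¹) ∙ (b ∙ b)
      ≈⟨ ∙-congʳ (assoc _ _ _) ⟨
    ((a ⁻¹ ∙ b ⁻¹ ∙ a) // b) ∙ (b ∙ b)
      ≈⟨ //-∙-cancel (a ⁻¹ ∙ b ⁻¹ ∙ a) b b ⟩
    commutator G a b
      ∎

  commutatorSubgroup⊆squareSubgroup : ∀ x → C x → SquareSubgroup G x
  commutatorSubgroup⊆squareSubgroup _ = Gen-⊆ λ where
    (a , b , x≈[a,b]) → resp (trans (squares≈commutator a b) (sym x≈[a,b]))
      (mul (mul (gen (a ⁻¹ , refl)) (gen (a ∙ b ⁻¹ , refl))) (gen (b , refl)))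

  infixr 8 _^_
  _^_ : Carrier → ℕ → Carrier
  x ^ n = n Mult.× x

  ^-∙-comm : ∀ x m n → x ^ m ∙ x ^ n ≈ x ^ n ∙ x ^ m
  ^-∙-comm x m n = begin
    x ^ m ∙ x ^ n ≈⟨ Mult.×-homo-+ x m n ⟨
    x ^ (m + n)   ≈⟨ Mult.×-congˡ (+-comm m n) ⟩
    x ^ (n + m)   ≈⟨ Mult.×-homo-+ x n m ⟩
    x ^ n ∙ x ^ m ∎

  ^-double : ∀ x n → x ^ (2 * n) ≈ x ^ n ∙ x ^ n
  ^-double x n = trans (Mult.×-homo-+ x n (n + 0)) (∙-congˡ (Mult.×-congˡ (+-identityʳ n)))

  ε^n≈ε : ∀ n → ε ^ n ≈ ε
  ε^n≈ε zero    = refl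
  ε^n≈ε (suc n) = trans (identityˡ _) (ε^n≈ε n)

  ^-⁻¹ : ∀ x n → (x ⁻¹) ^ n ≈ (x ^ n) ⁻¹
  ^-⁻¹ x zero    = sym ε⁻¹≈ε
  ^-⁻¹ x (suc n) = begin
    x ⁻¹ ∙ (x ⁻¹) ^ n   ≈⟨ ∙-congˡ (^-⁻¹ x n) ⟩
    x ⁻¹ ∙ (x ^ n) ⁻¹   ≈⟨ ⁻¹-anti-homo-∙ (x ^ n) x ⟨
    (x ^ n ∙ x) ⁻¹      ≈⟨ ⁻¹-cong (∙-congˡ (Mult.×-homo-1 x)) ⟨
    (x ^ n ∙ x ^ 1) ⁻¹  ≈⟨ ⁻¹-cong (^-∙-comm x n 1) ⟩
    (x ^ 1 ∙ x ^ n) ⁻¹  ≈⟨ ⁻¹-cong (∙-congʳ (Mult.×-homo-1 x)) ⟩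
    (x ^ suc n) ⁻¹      ∎

  ^-+≈^⇔^≈ε : ∀ x p d → x ^ (p + d) ≈ x ^ p ⇔ x ^ d ≈ ε
  ^-+≈^⇔^≈ε x p d = mk⇔
    (λ e → ∙-cancelˡ (x ^ p) _ _ (trans (sym (Mult.×-homo-+ x p d)) (trans e (sym (identityʳ _)))))
    (λ e → trans (Mult.×-homo-+ x p d) (trans (∙-congˡ e) (identityʳ _)))

  SameOrder : Carrier → Carrier → Set ℓ
  SameOrder a b = ∀ d → a ^ d ≈ ε ⇔ b ^ d ≈ ε

  sameOrder-sym : ∀ {a b} → SameOrder a b → SameOrder b a
  sameOrder-sym a≍b d = ⇔-sym (a≍b d)

  sameOrder-⁻¹ : ∀ x → SameOrder (x ⁻¹) x
  sameOrder-⁻¹ x d = mk⇔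
    (λ e → begin
      x ^ d               ≈⟨ ⁻¹-involutive _ ⟨
      ((x ^ d) ⁻¹) ⁻¹     ≈⟨ ⁻¹-cong (trans (sym (^-⁻¹ x d)) e) ⟩
      ε ⁻¹                ≈⟨ ε⁻¹≈ε ⟩
      ε                   ∎)
    (λ e → trans (^-⁻¹ x d) (trans (⁻¹-cong e) ε⁻¹≈ε))

  ^-+-transfer : ∀ {a b} → SameOrder a b → ∀ p d → a ^ (p + d) ≈ a ^ p → b ^ (p + d) ≈ b ^ p
  ^-+-transfer {a} {b} a≍b p d = from (^-+≈^⇔^≈ε b p d) ∘ to (a≍b d) ∘ to (^-+≈^⇔^≈ε a p d)

  ^-transfer : ∀ {a b} → SameOrder a b → ∀ p q → a ^ p ≈ a ^ q → b ^ p ≈ b ^ q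
  ^-transfer a≍b p q a^p≈a^q with ≤-total p q
  ... | inj₁ p≤q with m≤n⇒∃[o]m+o≡n p≤q
  ...   | d , ≡.refl = sym (^-+-transfer a≍b p d (sym a^p≈a^q))
  ^-transfer a≍b p q a^p≈a^q | inj₂ q≤p with m≤n⇒∃[o]m+o≡n q≤p
  ...   | d , ≡.refl = ^-+-transfer a≍b q d a^p≈a^q

  -- Order 0 stands for infinite order.
  HasOrder : Carrier → ℕ → Set ℓ
  HasOrder a n = ∀ d → a ^ d ≈ ε ⇔ n ∣ d

  hasOrder⇒sameOrder : ∀ {a b n} → HasOrder a n → HasOrder b n → SameOrder a b
  hasOrder⇒sameOrder oa ob d = ⇔-sym (ob d) ⇔-∘ oa d

  hasOrder-^ : ∀ {a q} p .{{_ : NonZero p}} → HasOrder a (q * p) → HasOrder (a ^ p) q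
  hasOrder-^ {a} p oa d = mk⇔
    (λ e → *-cancelʳ-∣ p (to (oa (d * p)) (trans (sym (Mult.×-assocˡ a d p)) e)))
    (λ q∣d → trans (Mult.×-assocˡ a d p) (from (oa (d * p)) (*-monoˡ-∣ p q∣d)))

  ∣⇒^≈ε : ∀ {a n d} → a ^ n ≈ ε → n ∣ d → a ^ d ≈ ε
  ∣⇒^≈ε {a} {n} a^n≈ε (divides q ≡.refl) = begin
    a ^ (q * n)  ≈⟨ Mult.×-assocˡ a q n ⟨
    (a ^ n) ^ q  ≈⟨ Mult.×-congʳ q a^n≈ε ⟩
    ε ^ q        ≈⟨ ε^n≈ε q ⟩
    ε            ∎

  hasOrder-0 : ∀ {a} → (∀ d → ¬ a ^ suc d ≈ ε) → HasOrder a 0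
  hasOrder-0 _       zero    = mk⇔ (λ _ → 0 ∣0) (λ _ → refl)
  hasOrder-0 noPower (suc d) =
    mk⇔ (λ e → contradiction e (noPower d)) (λ 0∣ → contradiction (0∣⇒≡0 0∣) λ ())

  hasOrder-suc : ∀ {a m} → IsLeast (λ k → a ^ suc k ≈ ε) m → HasOrder a (suc m)
  hasOrder-suc {a} {m} (a^[1+m]≈ε , least) d =
    mk⇔ (m%n≡0⇒n∣m d (suc m) ∘ remainder≡0) (∣⇒^≈ε a^[1+m]≈ε)
    where
    r = d % suc m
    q = d / suc m

    a^r≈ε : a ^ d ≈ ε → a ^ r ≈ ε
    a^r≈ε a^d≈ε = begin
      a ^ r                   ≈⟨ identityʳ _ ⟨
      a ^ r ∙ ε               ≈⟨ ∙-congˡ (∣⇒^≈ε a^[1+m]≈ε (n∣m*n q)) ⟨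
      a ^ r ∙ a ^ (q * suc m) ≈⟨ Mult.×-homo-+ a r (q * suc m) ⟨
      a ^ (r + q * suc m)     ≈⟨ Mult.×-congˡ (m≡m%n+[m/n]*n d (suc m)) ⟨
      a ^ d                   ≈⟨ a^d≈ε ⟩
      ε                       ∎

    below-order≡0 : ∀ k → k < suc m → a ^ k ≈ ε → k ≡ 0
    below-order≡0 zero    _         _ = ≡.refl
    below-order≡0 (suc k) (s≤s k<m) e = contradiction e (least k<m)

    remainder≡0 : a ^ d ≈ ε → r ≡ 0
    remainder≡0 = below-order≡0 r (m%n<n d (suc m)) ∘ a^r≈ε

  ¬¬-hasOrder : ∀ a → ¬ ¬ ∃ (HasOrder a)
  ¬¬-hasOrder a noOrder = ¬¬-excluded-middle {A = ∃ λ d → a ^ suc d ≈ ε} λ where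
    (no noPower)  → noOrder (0 , hasOrder-0 λ d e → noPower (d , e))
    (yes (d , e)) → ¬¬-least (λ k → a ^ suc k ≈ ε) {d} e λ (m , least) →
      noOrder (suc m , hasOrder-suc least)

  ⟨_⟩ : Carrier → Pred Carrier (c ⊔ ℓ)
  ⟨ a ⟩ = FinGen G (a ∷ [])

  _^±_ : Carrier → ℕ × ℕ → Carrier
  a ^± (m , n) = a ^ m // a ^ n

  exponents : ∀ {a x} → ⟨ a ⟩ x → ℕ × ℕ
  exponents (gen _)    = 1 , 0
  exponents one        = 0 , 0
  exponents (mul p q)  = exponents p +± exponents q
  exponents (inv p)    = swap (exponents p)
  exponents (resp _ p) = exponents p

  ^±-+± : ∀ a e f → a ^± e ∙ a ^± f ≈ a ^± (e +± f)
  ^±-+± a (m₁ , n₁) (m₂ , n₂) =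
    trans (//-∙-// (^-∙-comm a n₁ m₂))
          (//-cong₂ (sym (Mult.×-homo-+ a m₁ m₂)) (sym (Mult.×-homo-+ a n₂ n₁)))

  ≈-^±-exponents : ∀ {a x} (p : ⟨ a ⟩ x) → x ≈ a ^± exponents p
  ≈-^±-exponents {a} (gen (here x≈a)) = trans x≈a (sym (//-rightDividesʳ ε a))
  ≈-^±-exponents one                  = sym (inverseʳ ε)
  ≈-^±-exponents {a} (mul p q)        =
    trans (∙-cong (≈-^±-exponents p) (≈-^±-exponents q)) (^±-+± a (exponents p) (exponents q))
  ≈-^±-exponents (inv p)              = trans (⁻¹-cong (≈-^±-exponents p)) (⁻¹-anti-homo-// _ _)
  ≈-^±-exponents (resp x≈y p)         = trans (sym x≈y) (≈-^±-exponents p)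

  ^∈⟨⟩ : ∀ a n → ⟨ a ⟩ (a ^ n)
  ^∈⟨⟩ a zero    = one
  ^∈⟨⟩ a (suc n) = mul (gen (here refl)) (^∈⟨⟩ a n)

  ^±∈⟨⟩ : ∀ a e → ⟨ a ⟩ (a ^± e)
  ^±∈⟨⟩ a (m , n) = mul (^∈⟨⟩ a m) (inv (^∈⟨⟩ a n))

  ^±≈^±⇔^≈^ : ∀ a m n m′ n′ → a ^± (m , n) ≈ a ^± (m′ , n′) ⇔ a ^ (m + n′) ≈ a ^ (m′ + n)
  ^±≈^±⇔^≈^ a m n m′ n′ = mk⇔
    (λ e → begin
      a ^ (m + n′)                      ≈⟨ ^±∙^≈^ a m n n′ ⟨
      a ^± (m , n) ∙ (a ^ n ∙ a ^ n′)   ≈⟨ ∙-cong e (^-∙-comm a n n′) ⟩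
      a ^± (m′ , n′) ∙ (a ^ n′ ∙ a ^ n) ≈⟨ ^±∙^≈^ a m′ n′ n ⟩
      a ^ (m′ + n)                      ∎)
    (λ e → ∙-cancelʳ (a ^ n ∙ a ^ n′) _ _ (begin
      a ^± (m , n) ∙ (a ^ n ∙ a ^ n′)   ≈⟨ ^±∙^≈^ a m n n′ ⟩
      a ^ (m + n′)                      ≈⟨ e ⟩
      a ^ (m′ + n)                      ≈⟨ ^±∙^≈^ a m′ n′ n ⟨
      a ^± (m′ , n′) ∙ (a ^ n′ ∙ a ^ n) ≈⟨ ∙-congˡ (^-∙-comm a n′ n) ⟩
      a ^± (m′ , n′) ∙ (a ^ n ∙ a ^ n′) ∎))
    where
    ^±∙^≈^ : ∀ a m n k → a ^± (m , n) ∙ (a ^ n ∙ a ^ k) ≈ a ^ (m + k)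
    ^±∙^≈^ a m n k = trans (//-∙-cancel (a ^ m) (a ^ n) (a ^ k)) (sym (Mult.×-homo-+ a m k))

  ^±-transfer : ∀ {a b} → SameOrder a b → ∀ e f → a ^± e ≈ a ^± f → b ^± e ≈ b ^± f
  ^±-transfer {a} {b} a≍b (m , n) (m′ , n′) =
    from (^±≈^±⇔^≈^ b m n m′ n′) ∘ ^-transfer a≍b (m + n′) (m′ + n) ∘ to (^±≈^±⇔^≈^ a m n m′ n′)

  cyclicIsomorphism : ∀ {a b} → SameOrder a b → FinPartialAut G
  cyclicIsomorphism {a} {b} a≍b = record
    { dom-gens = a ∷ []
    ; cod-gens = b ∷ []
    ; fun      = λ _ p → b ^± exponents p
    ; fun-cong = λ p q x≈y → a→b p q (trans (sym (≈-^±-exponents p)) (trans x≈y (≈-^±-exponents q)))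
    ; fun-hom  = λ p q r → trans
        (a→b r (mul p q) (trans (sym (≈-^±-exponents r))
                                (trans (∙-cong (≈-^±-exponents p) (≈-^±-exponents q))
                                       (^±-+± a (exponents p) (exponents q)))))
        (sym (^±-+± b (exponents p) (exponents q)))
    ; fun-inj  = λ p q fp≈fq →
        trans (≈-^±-exponents p) (trans (b→a p q fp≈fq) (sym (≈-^±-exponents q)))
    ; fun-into = λ p → ^±∈⟨⟩ b (exponents p)
    ; fun-onto = λ q → let p = ^±∈⟨⟩ a (exponents q) in
        a ^± exponents q , p , trans (a→b p q (sym (≈-^±-exponents p))) (sym (≈-^±-exponents q))
    }
    where
    a→b : ∀ {u v x y} (p : ⟨ u ⟩ x) (q : ⟨ v ⟩ y) → a ^± exponents p ≈ a ^± exponents q →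
          b ^± exponents p ≈ b ^± exponents q
    a→b p q = ^±-transfer a≍b (exponents p) (exponents q)
    b→a : ∀ {u v x y} (p : ⟨ u ⟩ x) (q : ⟨ v ⟩ y) → b ^± exponents p ≈ b ^± exponents q →
          a ^± exponents p ≈ a ^± exponents q
    b→a p q = ^±-transfer (sameOrder-sym a≍b) (exponents p) (exponents q)

  module _ (iu : InnerUltrahomogeneous G) where

    sameOrder⇒conjugate : ∀ {a b} → SameOrder a b → ∃ λ g → conj G a g ≈ b
    sameOrder⇒conjugate {a} {b} a≍b =
      let g , conj≈fun = iu (cyclicIsomorphism a≍b)
      in g , trans (conj≈fun a (gen (here refl))) (//-rightDividesʳ ε b)

    sameOrder⇒∼ : ∀ {a b} → SameOrder a b → a ∼ b
    sameOrder⇒∼ {a} a≍b =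
      let g , a^g≈b = sameOrder⇒conjugate a≍b in resp (∙-congˡ a^g≈b) (∼-conj a g)

    square∈C : ∀ g → C (g ∙ g)
    square∈C g = resp (∙-congʳ (⁻¹-involutive g)) (sameOrder⇒∼ (sameOrder-⁻¹ g))

    squareSubgroup⊆commutatorSubgroup : ∀ x → SquareSubgroup G x → C x
    squareSubgroup⊆commutatorSubgroup _ = Gen-⊆ λ where
      (g , x≈gg) → resp (sym x≈gg) (square∈C g)

    twoDivisible⇒perfect : TwoDivisible G → ∀ x → C x
    twoDivisible⇒perfect half x = let g , gg≈x = half x in resp gg≈x (square∈C g)

    ∼⇒∙∈C : ∀ {x y} → x ∼ y → C (x ∙ y)
    ∼⇒∙∈C {x} {y} x∼y =
      resp (trans (assoc _ _ _) (∙-congˡ (\\-leftDividesˡ x y))) (mul (square∈C x) x∼y)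

    ^-even∈C : ∀ x n → C (x ^ (2 * n))
    ^-even∈C x n = resp (sym (^-double x n)) (square∈C (x ^ n))

    ∼-^-odd : ∀ x s → x ∼ x ^ suc (2 * s)
    ∼-^-odd x s = resp (sym (\\-leftDividesʳ x _)) (^-even∈C x s)

    finiteOrder⇒∼2^-order : ∀ {x n} → HasOrder x (suc n) → ∃₂ λ i y → x ∼ y × HasOrder y (2 ℕ.^ i)
    finiteOrder⇒∼2^-order {x} {n} ox =
      let i , s , eq = 1+n≡2^i*[1+2s] n
      in i , x ^ suc (2 * s) , ∼-^-odd x s , hasOrder-^ (suc (2 * s)) (≡.subst (HasOrder x) eq ox)

    2^-order-<⇒∈C : ∀ {x y i j} → HasOrder x (2 ℕ.^ i) → HasOrder y (2 ℕ.^ j) → i < j → C x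
    2^-order-<⇒∈C {x} {y} {i} ox oy i<j with m≤n⇒∃[o]m+o≡n i<j
    ... | k , ≡.refl = ∈-resp-∼ (sameOrder⇒∼ (hasOrder⇒sameOrder oy′ ox)) (^-even∈C y (2 ℕ.^ k))
      where
      2^[1+i+k]≡2^i*2^[1+k] : 2 ℕ.^ (suc i + k) ≡ 2 ℕ.^ i * 2 ℕ.^ suc k
      2^[1+i+k]≡2^i*2^[1+k] =
        ≡.trans (≡.cong (2 ℕ.^_) (≡.sym (+-suc i k))) (^-distribˡ-+-* 2 i (suc k))
      oy′ : HasOrder (y ^ (2 ℕ.^ suc k)) (2 ℕ.^ i)
      oy′ = hasOrder-^ (2 ℕ.^ suc k) {{m^n≢0 2 (suc k)}}
              (≡.subst (HasOrder y) 2^[1+i+k]≡2^i*2^[1+k] oy)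

    2^-orders-trichotomy : ∀ {x y} i j → HasOrder x (2 ℕ.^ i) → HasOrder y (2 ℕ.^ j) →
                           C x ⊎ C y ⊎ x ∼ y
    2^-orders-trichotomy i j ox oy with <-cmp i j
    ... | tri< i<j _ _    = inj₁ (2^-order-<⇒∈C ox oy i<j)
    ... | tri> _ _ j<i    = inj₂ (inj₁ (2^-order-<⇒∈C oy ox j<i))
    ... | tri≈ _ ≡.refl _ = inj₂ (inj₂ (sameOrder⇒∼ (hasOrder⇒sameOrder ox oy)))

    finiteOrders⇒∼ : ∀ {x y n m} → HasOrder x (suc n) → HasOrder y (suc m) → ¬ C x → ¬ C y → x ∼ y
    finiteOrders⇒∼ ox oy x∉C y∉C with finiteOrder⇒∼2^-order ox | finiteOrder⇒∼2^-order oy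
    ... | i , x′ , x∼x′ , ox′ | j , y′ , y∼y′ , oy′ with 2^-orders-trichotomy i j ox′ oy′
    ...   | inj₁ x′∈C         = contradiction (∈-resp-∼ (∼-sym x∼x′) x′∈C) x∉C
    ...   | inj₂ (inj₁ y′∈C)  = contradiction (∈-resp-∼ (∼-sym y∼y′) y′∈C) y∉C
    ...   | inj₂ (inj₂ x′∼y′) = ∼-trans x∼x′ (∼-trans x′∼y′ (∼-sym y∼y′))

    ∉C∙∉C⇒¬¬∈C : ∀ {u v} → ¬ C u → ¬ C v → ¬ ¬ C (u ∙ v)
    ∉C∙∉C⇒¬¬∈C {u} {v} u∉C v∉C uv∉C =
      ¬¬-hasOrder u λ (n , ou) → ¬¬-hasOrder v λ (m , ov) → ¬¬-hasOrder (u ∙ v) λ (k , ouv) →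
      pigeonhole n m k ou ov ouv
      where
      u≁v : ¬ u ∼ v
      u≁v = uv∉C ∘ ∼⇒∙∈C
      u≁uv : ¬ u ∼ u ∙ v
      u≁uv = v∉C ∘ resp (\\-leftDividesʳ u v)
      v≁uv : ¬ v ∼ u ∙ v
      v≁uv = u∉C ∘ ∈-resp-∼ (∼-sym (∼-conj u v)) ∘ resp (sym (assoc _ _ _))

      pigeonhole : ∀ n m k → HasOrder u n → HasOrder v m → HasOrder (u ∙ v) k → ⊥
      pigeonhole zero    zero    _       ou ov _   = u≁v (sameOrder⇒∼ (hasOrder⇒sameOrder ou ov))
      pigeonhole (suc _) (suc _) _       ou ov _   = u≁v (finiteOrders⇒∼ ou ov u∉C v∉C)
      pigeonhole zero    (suc _) zero    ou _  ouv = u≁uv (sameOrder⇒∼ (hasOrder⇒sameOrder ou ouv))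
      pigeonhole (suc _) zero    (suc _) ou _  ouv = u≁uv (finiteOrders⇒∼ ou ouv u∉C uv∉C)
      pigeonhole zero    (suc _) (suc _) _  ov ouv = v≁uv (finiteOrders⇒∼ ov ouv v∉C uv∉C)
      pigeonhole (suc _) zero    zero    _  ov ouv = v≁uv (sameOrder⇒∼ (hasOrder⇒sameOrder ov ouv))

    indexAtMostTwo : IndexAtMostTwo G C
    indexAtMostTwo x y z (x≁y , x≁z , y≁z) = ∉C∙∉C⇒¬¬∈C x≁y y≁z (x≁z ∘ resp (\\-∙-\\ x y z))

proposition4p29 : {c ℓ : Level} (Γ : Group c ℓ) → InnerUltrahomogeneous Γ →
    ((∀ x → CommutatorSubgroup Γ x → SquareSubgroup Γ x) ×
     (∀ x → SquareSubgroup Γ x → CommutatorSubgroup Γ x)) ×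
    (TwoDivisible Γ → ∀ x → CommutatorSubgroup Γ x) ×
    IndexAtMostTwo Γ (CommutatorSubgroup Γ)
proposition4p29 Γ iu =
    (commutatorSubgroup⊆squareSubgroup Γ , squareSubgroup⊆commutatorSubgroup Γ iu)
  , twoDivisible⇒perfect Γ iu
  , indexAtMostTwo Γ iu
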